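{- Let $A,B\in\mathbb{N}_m$ with $|A|,|B|\ge2$ and $\underline{\alpha},\underline{\beta}\in\mathbb{Z}^+_m$ satisfy $\underline{\alpha}A=\underline{\beta}B$ with $(A,\underline{\alpha})\neq(B,\underline{\beta})$. Then $A\ne B$ and $\underline{\alpha}\ne\underline{\beta}$.
   Context: A multiset $M$ of nonnegative integers is described by its multiplicity function $\chi_M$; $|M|=\sum_n\chi_M(n)$. $\mathbb{N}_m$ is the family of multisets $M$ of nonnegative integers with $\chi_M(0)=1$ and $\chi_M(n)<\infty$ for $n\ge1$. $\mathbb{Z}^+_m$ is the set of finite vectors $(\alpha_1,\dots,\alpha_s)$ ($s\ge1$ arbitrary) of positive integers with $\alpha_1\le\cdots\le\alpha_s$. For a multiset $A=\{a_1\le a_2\le\cdots\}$ (listed with multiplicity), $\underline{\alpha}A=\alpha_1A+\cdots+\alpha_sA$ is the multiset in which $n$ has multiplicity $R_{A,\underline{\alpha}}(n)=|\{(j_1,\dots,j_s)\in(\mathbb{Z}^+)^s:\sum_i\alpha_ia_{j_i}=n\}|$ (here $kA=\{ka\}$ and multiset sums count all pairs with multiplicity). -}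

module Defs where

open import Data.Nat using (ℕ; zero; suc; _+_; _*_; _∸_; _≤_; _≟_)
open import Data.List using (List; []; _∷_)
open import Data.List.Relation.Unary.All using (All)
open import Data.List.Relation.Unary.Linked using (Linked)
open import Data.Product using (_×_; ∃)
open import Relation.Nullary.Decidable using (does)
open import Data.Bool using (if_then_else_)

sumUpTo : ℕ → (ℕ → ℕ) → ℕ
sumUpTo zero    f = f 0
sumUpTo (suc n) f = sumUpTo n f + f (suc n)

-- A multiset of nonnegative integers, given by its multiplicity function χ_M.
-- Finiteness of multiplicities is automatic (values in ℕ).
Multiset : Set
Multiset = ℕ → ℕ

InNm : Multiset → Set
InNm χ = χ 0 ≡ 1
  where open import Relation.Binary.PropositionalEquality using (_≡_)

-- |M| ≥ 2 : some initial segment {0..N} already contains ≥ 2 elements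
-- (|M| = Σ_n χ_M(n), possibly infinite).
CardGe2 : Multiset → Set
CardGe2 χ = ∃ λ N → 2 ≤ sumUpTo N χ

data NonEmpty : List ℕ → Set where
  nonEmpty : ∀ {a as} → NonEmpty (a ∷ as)

InZm : List ℕ → Set
InZm α = NonEmpty α × All (λ a → 1 ≤ a) α × Linked _≤_ α

dilate : ℕ → Multiset → Multiset
dilate k χ n = sumUpTo n (λ m → if does (k * m ≟ n) then χ m else 0)

_⊕_ : Multiset → Multiset → Multiset
(f ⊕ g) n = sumUpTo n (λ i → f i * g (n ∸ i))

δ₀ : Multiset
δ₀ zero    = 1
δ₀ (suc _) = 0

dilSum : List ℕ → Multiset → Multiset
dilSum []      χ = δ₀
dilSum (a ∷ []) χ = dilate a χ
dilSum (a ∷ α@(_ ∷ _)) χ = dilate a χ ⊕ dilSum α χ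

-- If A = B, let c be the least positive element of A. The least positive element of
-- α̲A is α₁c, so α₁ = β₁; the summand α₁A has multiplicity 1 at 0 and cancels from
-- α̲A = β̲A, and induction on the length gives α = β. If α = β but A ≠ B, take the
-- least n with χ_A(n) < χ_B(n) (say): α̲A ≤ α̲B pointwise up to α₁n, with strict
-- inequality at α₁n, which contradicts α̲A = α̲B.
module Submission where

open import Defs
open import Data.Nat using (ℕ; zero; suc; _+_; _*_; _∸_; _≤_; _<_; _≮_; _≟_; z≤n; s≤s; z<s; >-nonZero)
open import Data.Nat.Properties
open import Data.Nat.Induction using (<-rec)
open import Data.List using (List; []; _∷_)
open import Data.List.Relation.Unary.All as All using (All; []; _∷_)
open import Data.List.Relation.Unary.Linked as Linked using (Linked)
open import Data.List.Relation.Unary.Linked.Properties using (Linked⇒All)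
open import Data.Product using (_×_; _,_; ∃; proj₂)
open import Data.Sum using (_⊎_; inj₁; inj₂)
open import Data.Empty using (⊥-elim)
open import Data.Bool using (if_then_else_)
open import Function using (_∘_)
open import Relation.Nullary using (¬_; Dec; yes; no; contradiction)
open import Relation.Nullary.Decidable using (does; dec-true)
open import Relation.Binary.PropositionalEquality

sumUpTo-cong : ∀ n {f g : ℕ → ℕ} → (∀ {i} → i ≤ n → f i ≡ g i) → sumUpTo n f ≡ sumUpTo n g
sumUpTo-cong zero    f≡g = f≡g z≤n
sumUpTo-cong (suc n) f≡g = cong₂ _+_ (sumUpTo-cong n (f≡g ∘ m≤n⇒m≤1+n)) (f≡g ≤-refl)

sumUpTo-zero : ∀ n {f : ℕ → ℕ} → (∀ {i} → i ≤ n → f i ≡ 0) → sumUpTo n f ≡ 0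
sumUpTo-zero zero    f≡0 = f≡0 z≤n
sumUpTo-zero (suc n) f≡0 = cong₂ _+_ (sumUpTo-zero n (f≡0 ∘ m≤n⇒m≤1+n)) (f≡0 ≤-refl)

sumUpTo-mono-≤ : ∀ n {f g : ℕ → ℕ} → (∀ {i} → i ≤ n → f i ≤ g i) → sumUpTo n f ≤ sumUpTo n g
sumUpTo-mono-≤ zero    f≤g = f≤g z≤n
sumUpTo-mono-≤ (suc n) f≤g = +-mono-≤ (sumUpTo-mono-≤ n (f≤g ∘ m≤n⇒m≤1+n)) (f≤g ≤-refl)

sumUpTo-mono-< : ∀ n {f g : ℕ → ℕ} {k} → (∀ {i} → i ≤ n → f i ≤ g i) →
                 k ≤ n → f k < g k → sumUpTo n f < sumUpTo n g
sumUpTo-mono-< zero    f≤g z≤n fk<gk = fk<gk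
sumUpTo-mono-< (suc n) f≤g k≤1+n fk<gk with m≤n⇒m<n∨m≡n k≤1+n
... | inj₁ k<1+n = +-mono-<-≤ (sumUpTo-mono-< n (f≤g ∘ m≤n⇒m≤1+n) (≤-pred k<1+n) fk<gk) (f≤g ≤-refl)
... | inj₂ refl  = +-mono-≤-< (sumUpTo-mono-≤ n (f≤g ∘ m≤n⇒m≤1+n)) fk<gk

≤-sumUpTo : ∀ n {f : ℕ → ℕ} {k} → k ≤ n → f k ≤ sumUpTo n f
≤-sumUpTo zero    z≤n   = ≤-refl
≤-sumUpTo (suc n) k≤1+n with m≤n⇒m<n∨m≡n k≤1+n
... | inj₁ k<1+n = ≤-trans (≤-sumUpTo n (≤-pred k<1+n)) (m≤m+n _ _)
... | inj₂ refl  = m≤n+m _ _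

sumUpTo-suc : ∀ n (f : ℕ → ℕ) → sumUpTo (suc n) f ≡ f 0 + sumUpTo n (f ∘ suc)
sumUpTo-suc zero    f = refl
sumUpTo-suc (suc n) f = trans (cong (_+ f (2 + n)) (sumUpTo-suc n f)) (+-assoc (f 0) _ _)

if-does-≤ : ∀ {P : Set} (d : Dec P) {x y : ℕ} → (P → x ≤ y) →
            (if does d then x else 0) ≤ (if does d then y else 0)
if-does-≤ (yes p) x≤y = x≤y p
if-does-≤ (no _)  _   = z≤n

if-does-yes : ∀ {P : Set} (d : Dec P) {x : ℕ} → P → (if does d then x else 0) ≡ x
if-does-yes d {x} p = cong (λ b → if b then x else 0) (dec-true d p)

if-does-≡0 : ∀ {P : Set} (d : Dec P) {x : ℕ} → (P → x ≡ 0) → (if does d then x else 0) ≡ 0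
if-does-≡0 (yes p) x≡0 = x≡0 p
if-does-≡0 (no _)  _   = refl

positive-factorʳ : ∀ k j {m} → k * j ≡ m → 0 < m → 0 < j
positive-factorʳ k zero    kj≡m 0<m = contradiction (trans (sym (*-zeroʳ k)) kj≡m) (m<n⇒n≢0 0<m ∘ sym)
positive-factorʳ k (suc j) _    _   = z<s

_≤[_]_ : Multiset → ℕ → Multiset → Set
f ≤[ N ] g = ∀ {i} → i ≤ N → f i ≤ g i

≤[]-restrict : ∀ {f g M N} → M ≤ N → f ≤[ N ] g → f ≤[ M ] g
≤[]-restrict M≤N f≤g i≤M = f≤g (≤-trans i≤M M≤N)

≤[]-from-prefix : ∀ {f g n} → (∀ {m} → m < n → f m ≡ g m) → f n ≤ g n → f ≤[ n ] g
≤[]-from-prefix prefix fn≤gn i≤n with m≤n⇒m<n∨m≡n i≤n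
... | inj₁ i<n = ≤-reflexive (prefix i<n)
... | inj₂ refl = fn≤gn

VanishesBelow : ℕ → Multiset → Set
VanishesBelow N f = ∀ {m} → 0 < m → m < N → f m ≡ 0

record IsLeastPositive (f : Multiset) (c : ℕ) : Set where
  field
    positive : 0 < c
    occurs   : 0 < f c
    vanishes : VanishesBelow c f

IsLeastPositive-resp : ∀ {f g c} → f ≗ g → IsLeastPositive f c → IsLeastPositive g c
IsLeastPositive-resp f≗g lp = record
  { positive = positive
  ; occurs   = subst (0 <_) (f≗g _) occurs
  ; vanishes = λ 0<m m<c → trans (sym (f≗g _)) (vanishes 0<m m<c)
  }
  where open IsLeastPositive lp

IsLeastPositive-unique : ∀ {f c d} → IsLeastPositive f c → IsLeastPositive f d → c ≡ d
IsLeastPositive-unique {f} lc ld = ≤-antisym (≮⇒≥ (below ld lc)) (≮⇒≥ (below lc ld))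
  where
  open IsLeastPositive
  below : ∀ {c d} → IsLeastPositive f c → IsLeastPositive f d → c ≮ d
  below lc ld c<d = <⇒≢ (occurs lc) (sym (vanishes ld (positive lc) c<d))

δ₀-vanishes : ∀ {N} → VanishesBelow N δ₀
δ₀-vanishes z<s _ = refl

δ₀-noLeastPositive : ∀ {c} → ¬ IsLeastPositive δ₀ c
δ₀-noLeastPositive lp = <⇒≢ occurs (sym (δ₀-vanishes positive (n<1+n _)))
  where open IsLeastPositive lp

VanishesBelow-extend : ∀ {f N} → VanishesBelow N f → f N ≡ 0 → VanishesBelow (suc N) f
VanishesBelow-extend vanishes fN≡0 0<m m<1+N with m≤n⇒m<n∨m≡n (≤-pred m<1+N)
... | inj₁ m<N = vanishes 0<m m<N
... | inj₂ refl = fN≡0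

leastPositive-upTo : ∀ (f : Multiset) N → ∃ (IsLeastPositive f) ⊎ VanishesBelow (suc N) f
leastPositive-upTo f zero = inj₂ λ { (s≤s _) (s≤s ()) }
leastPositive-upTo f (suc N) with leastPositive-upTo f N | f (suc N) ≟ 0
... | inj₁ found    | _              = inj₁ found
... | inj₂ vanishes | yes f[1+N]≡0 = inj₂ (VanishesBelow-extend vanishes f[1+N]≡0)
... | inj₂ vanishes | no f[1+N]≢0  = inj₁ (suc N , record
  { positive = z<s ; occurs = n≢0⇒n>0 f[1+N]≢0 ; vanishes = vanishes })

sumUpTo-vanishing : ∀ (f : Multiset) N → VanishesBelow (suc N) f → sumUpTo N f ≡ f 0
sumUpTo-vanishing f zero    _        = refl
sumUpTo-vanishing f (suc N) vanishes = begin
  sumUpTo N f + f (suc N) ≡⟨ cong₂ _+_ (sumUpTo-vanishing f N (λ 0<m → vanishes 0<m ∘ m≤n⇒m≤1+n)) (vanishes z<s ≤-refl) ⟩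
  f 0 + 0                 ≡⟨ +-identityʳ (f 0) ⟩
  f 0                     ∎
  where open ≡-Reasoning

leastPositive : ∀ {A} → InNm A → CardGe2 A → ∃ (IsLeastPositive A)
leastPositive {A} A0≡1 (N , 2≤ΣA) with leastPositive-upTo A N
... | inj₁ found    = found
... | inj₂ vanishes = contradiction (subst (2 ≤_) (trans (sumUpTo-vanishing A N vanishes) A0≡1) 2≤ΣA) (<-irrefl refl)

⊕-cong : ∀ {f f′ g g′} → f ≗ f′ → g ≗ g′ → f ⊕ g ≗ f′ ⊕ g′
⊕-cong f≗f′ g≗g′ n = sumUpTo-cong n λ {i} _ → cong₂ _*_ (f≗f′ i) (g≗g′ (n ∸ i))

⊕-identityʳ : ∀ f → f ⊕ δ₀ ≗ f
⊕-identityʳ f zero    = *-identityʳ (f 0)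
⊕-identityʳ f (suc n) = begin
  sumUpTo n (λ i → f i * δ₀ (suc n ∸ i)) + f (suc n) * δ₀ (suc n ∸ suc n)
    ≡⟨ cong₂ _+_ (sumUpTo-zero n λ {i} i≤n → trans (cong (λ k → f i * δ₀ k) (+-∸-assoc 1 i≤n)) (*-zeroʳ (f i)))
                 (cong (λ k → f (suc n) * δ₀ k) (n∸n≡0 n)) ⟩
  0 + f (suc n) * 1
    ≡⟨ *-identityʳ (f (suc n)) ⟩
  f (suc n) ∎
  where open ≡-Reasoning

⊕-positive : ∀ f g n → 0 < f n → 0 < g 0 → 0 < (f ⊕ g) n
⊕-positive f g n 0<fn 0<g0 = ≤-trans (*-mono-≤ 0<fn (subst (λ k → 0 < g k) (sym (n∸n≡0 n)) 0<g0))
                                     (≤-sumUpTo n {λ i → f i * g (n ∸ i)} ≤-refl)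

⊕-mono-≤ : ∀ {f f′ g g′ N} → f ≤[ N ] f′ → g ≤[ N ] g′ → (f ⊕ g) ≤[ N ] (f′ ⊕ g′)
⊕-mono-≤ f≤f′ g≤g′ {n} n≤N = sumUpTo-mono-≤ n λ {i} i≤n →
  *-mono-≤ (f≤f′ (≤-trans i≤n n≤N)) (g≤g′ (≤-trans (m∸n≤m n i) n≤N))

⊕-mono-< : ∀ {f f′ g g′ N} → f ≤[ N ] f′ → g ≤[ N ] g′ → f N < f′ N → 0 < g 0 → (f ⊕ g) N < (f′ ⊕ g′) N
⊕-mono-< {f} {f′} {g} {g′} {N} f≤f′ g≤g′ fN<f′N 0<g0 = sumUpTo-mono-< N terms≤ ≤-refl lastTerm<
  where
  terms≤ : ∀ {i} → i ≤ N → f i * g (N ∸ i) ≤ f′ i * g′ (N ∸ i)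
  terms≤ {i} i≤N = *-mono-≤ (f≤f′ i≤N) (g≤g′ (m∸n≤m N i))
  lastTerm< : f N * g (N ∸ N) < f′ N * g′ (N ∸ N)
  lastTerm< rewrite n∸n≡0 N = <-≤-trans (*-monoˡ-< (g 0) {{>-nonZero 0<g0}} fN<f′N) (*-monoʳ-≤ (f′ N) (g≤g′ z≤n))

⊕-vanishes : ∀ {f g N} → VanishesBelow N f → VanishesBelow N g → VanishesBelow N (f ⊕ g)
⊕-vanishes {f} {g} f-vanishes g-vanishes {m} 0<m m<N = sumUpTo-zero m term≡0
  where
  term≡0 : ∀ {i} → i ≤ m → f i * g (m ∸ i) ≡ 0
  term≡0 {zero}  _   = trans (cong (f 0 *_) (g-vanishes 0<m m<N)) (*-zeroʳ (f 0))
  term≡0 {suc i} i≤m = cong (_* g (m ∸ suc i)) (f-vanishes z<s (≤-<-trans i≤m m<N))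

⊕-cancelˡ : ∀ f {g h} → f 0 ≡ 1 → f ⊕ g ≗ f ⊕ h → g ≗ h
⊕-cancelˡ f {g} {h} f0≡1 fg≗fh = <-rec (λ n → g n ≡ h n) step
  where
  cancel-f0 : ∀ {x y} → f 0 * x ≡ f 0 * y → x ≡ y
  cancel-f0 {x} {y} rewrite f0≡1 = *-cancelˡ-≡ x y 1

  step : ∀ n → (∀ {m} → m < n → g m ≡ h m) → g n ≡ h n
  step zero    _     = cancel-f0 (fg≗fh 0)
  step (suc n) below = cancel-f0 (+-cancelʳ-≡ _ _ _ (begin
    f 0 * g (suc n) + sumUpTo n (λ i → f (suc i) * h (n ∸ i))
      ≡⟨ cong (f 0 * g (suc n) +_) (sumUpTo-cong n λ {i} _ → cong (f (suc i) *_) (below (s≤s (m∸n≤m n i)))) ⟨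
    f 0 * g (suc n) + sumUpTo n (λ i → f (suc i) * g (n ∸ i))
      ≡⟨ sumUpTo-suc n (λ i → f i * g (suc n ∸ i)) ⟨
    (f ⊕ g) (suc n)
      ≡⟨ fg≗fh (suc n) ⟩
    (f ⊕ h) (suc n)
      ≡⟨ sumUpTo-suc n (λ i → f i * h (suc n ∸ i)) ⟩
    f 0 * h (suc n) + sumUpTo n (λ i → f (suc i) * h (n ∸ i)) ∎))
    where open ≡-Reasoning

dilate-zero : ∀ k χ → dilate k χ 0 ≡ χ 0
dilate-zero k χ rewrite *-zeroʳ k = refl

dilate-cong : ∀ k {A B} → A ≗ B → dilate k A ≗ dilate k B
dilate-cong k A≗B n = sumUpTo-cong n λ {j} _ → cong (λ x → if does (k * j ≟ n) then x else 0) (A≗B j)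

dilate-≥ : ∀ {k} χ m → 0 < k → χ m ≤ dilate k χ (k * m)
dilate-≥ {k} χ m 0<k = ≤-trans (≤-reflexive (sym (if-does-yes (k * m ≟ k * m) refl)))
                               (≤-sumUpTo (k * m) (m≤n*m m k {{>-nonZero 0<k}}))

dilate-terms-≤ : ∀ k {A B n m} → 0 < k → A ≤[ n ] B → m ≤ k * n → ∀ {j} → j ≤ m →
                 (if does (k * j ≟ m) then A j else 0) ≤ (if does (k * j ≟ m) then B j else 0)
dilate-terms-≤ k {n = n} 0<k A≤B m≤kn {j} _ = if-does-≤ (k * j ≟ _) λ kj≡m →
  A≤B (*-cancelˡ-≤ k {{>-nonZero 0<k}} (subst (_≤ k * n) (sym kj≡m) m≤kn))

dilate-mono-≤ : ∀ k {A B n} → 0 < k → A ≤[ n ] B → dilate k A ≤[ k * n ] dilate k B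
dilate-mono-≤ k 0<k A≤B {m} m≤kn = sumUpTo-mono-≤ m (dilate-terms-≤ k 0<k A≤B m≤kn)

dilate-mono-< : ∀ k {A B n} → 0 < k → A ≤[ n ] B → A n < B n → dilate k A (k * n) < dilate k B (k * n)
dilate-mono-< k {A} {B} {n} 0<k A≤B An<Bn =
  sumUpTo-mono-< (k * n) (dilate-terms-≤ k 0<k A≤B ≤-refl) (m≤n*m n k {{>-nonZero 0<k}})
    (subst₂ _<_ (sym (if-does-yes (k * n ≟ k * n) refl)) (sym (if-does-yes (k * n ≟ k * n) refl)) An<Bn)

dilate-vanishes : ∀ {b k c A} → b ≤ k → VanishesBelow c A → VanishesBelow (b * c) (dilate k A)
dilate-vanishes {b} {k} {c} {A} b≤k A-vanishes {m} 0<m m<bc = sumUpTo-zero m λ {j} _ →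
  if-does-≡0 (k * j ≟ m) λ kj≡m →
    A-vanishes (positive-factorʳ k j kj≡m 0<m)
               (*-cancelˡ-< k j c (subst (_< k * c) (sym kj≡m) (<-≤-trans m<bc (*-monoˡ-≤ c b≤k))))

dilSum-cons : ∀ k α χ → dilSum (k ∷ α) χ ≗ dilate k χ ⊕ dilSum α χ
dilSum-cons k []      χ n = sym (⊕-identityʳ (dilate k χ) n)
dilSum-cons k (_ ∷ _) χ n = refl

dilSum-zero : ∀ α χ → χ 0 ≡ 1 → dilSum α χ 0 ≡ 1
dilSum-zero []              χ χ0≡1 = refl
dilSum-zero (k ∷ [])        χ χ0≡1 = trans (dilate-zero k χ) χ0≡1
dilSum-zero (k ∷ α@(_ ∷ _)) χ χ0≡1 = cong₂ _*_ (trans (dilate-zero k χ) χ0≡1) (dilSum-zero α χ χ0≡1)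

dilSum-cong : ∀ α {A B} → A ≗ B → dilSum α A ≗ dilSum α B
dilSum-cong []              A≗B = λ _ → refl
dilSum-cong (k ∷ [])        A≗B = dilate-cong k A≗B
dilSum-cong (k ∷ α@(_ ∷ _)) A≗B = ⊕-cong (dilate-cong k A≗B) (dilSum-cong α A≗B)

dilSum-mono-≤ : ∀ {a} α {A B n} → 0 < a → All (a ≤_) α → A ≤[ n ] B → dilSum α A ≤[ a * n ] dilSum α B
dilSum-mono-≤ {a} α {A} {B} {n} 0<a a≤α A≤B = go α a≤α
  where
  dilate≤ : ∀ {k} → a ≤ k → dilate k A ≤[ a * n ] dilate k B
  dilate≤ {k} a≤k = ≤[]-restrict (*-monoˡ-≤ n a≤k) (dilate-mono-≤ k (≤-trans 0<a a≤k) A≤B)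

  go : ∀ α → All (a ≤_) α → dilSum α A ≤[ a * n ] dilSum α B
  go []              []           _ = ≤-refl
  go (k ∷ [])        (a≤k ∷ [])     = dilate≤ a≤k
  go (k ∷ α@(_ ∷ _)) (a≤k ∷ a≤α)    = ⊕-mono-≤ (dilate≤ a≤k) (go α a≤α)

dilSum-mono-< : ∀ {a} α {A B n} → 0 < a → All (a ≤_) α → A 0 ≡ 1 → A ≤[ n ] B → A n < B n →
                dilSum (a ∷ α) A (a * n) < dilSum (a ∷ α) B (a * n)
dilSum-mono-< {a} α {A} {B} {n} 0<a a≤α A0≡1 A≤B An<Bn =
  subst₂ _<_ (sym (dilSum-cons a α A (a * n))) (sym (dilSum-cons a α B (a * n)))
    (⊕-mono-< (dilate-mono-≤ a 0<a A≤B) (dilSum-mono-≤ α 0<a a≤α A≤B)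
              (dilate-mono-< a 0<a A≤B An<Bn) (≤-reflexive (sym (dilSum-zero α A A0≡1))))

dilSum-vanishes : ∀ {b} β {c A} → All (b ≤_) β → VanishesBelow c A → VanishesBelow (b * c) (dilSum β A)
dilSum-vanishes []              []           A-vanishes = δ₀-vanishes
dilSum-vanishes (k ∷ [])        (b≤k ∷ [])   A-vanishes = dilate-vanishes b≤k A-vanishes
dilSum-vanishes (k ∷ β@(_ ∷ _)) (b≤k ∷ b≤β) A-vanishes =
  ⊕-vanishes (dilate-vanishes b≤k A-vanishes) (dilSum-vanishes β b≤β A-vanishes)

dilSum-leastPositive : ∀ {b β A c} → 0 < b → Linked _≤_ (b ∷ β) → A 0 ≡ 1 → IsLeastPositive A c →
                       IsLeastPositive (dilSum (b ∷ β) A) (b * c)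
dilSum-leastPositive {b} {β} {A} {c} 0<b sorted A0≡1 lp = record
  { positive = *-mono-≤ 0<b positive
  ; occurs   = subst (0 <_) (sym (dilSum-cons b β A (b * c)))
                 (⊕-positive (dilate b A) (dilSum β A) (b * c)
                   (≤-trans occurs (dilate-≥ A c 0<b)) (≤-reflexive (sym (dilSum-zero β A A0≡1))))
  ; vanishes = dilSum-vanishes (b ∷ β) (Linked⇒All ≤-trans ≤-refl sorted) vanishes
  }
  where open IsLeastPositive lp

dilSum-injectiveˡ : ∀ {A c} α β → A 0 ≡ 1 → IsLeastPositive A c →
                    All (0 <_) α → Linked _≤_ α → All (0 <_) β → Linked _≤_ β →
                    dilSum α A ≗ dilSum β A → α ≡ β
dilSum-injectiveˡ []      []      _    _  _ _ _ _ _ = refl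
dilSum-injectiveˡ []      (b ∷ β) A0≡1 lp _ _ (0<b ∷ _) β↑ αA≗βA =
  ⊥-elim (δ₀-noLeastPositive (IsLeastPositive-resp (sym ∘ αA≗βA) (dilSum-leastPositive 0<b β↑ A0≡1 lp)))
dilSum-injectiveˡ (a ∷ α) []      A0≡1 lp (0<a ∷ _) α↑ _ _ αA≗βA =
  ⊥-elim (δ₀-noLeastPositive (IsLeastPositive-resp αA≗βA (dilSum-leastPositive 0<a α↑ A0≡1 lp)))
dilSum-injectiveˡ {A} {c} (a ∷ α) (b ∷ β) A0≡1 lp (0<a ∷ 0<α) α↑ (0<b ∷ 0<β) β↑ αA≗βA
  with *-cancelʳ-≡ a b c {{>-nonZero (IsLeastPositive.positive lp)}}
         (IsLeastPositive-unique (IsLeastPositive-resp αA≗βA (dilSum-leastPositive 0<a α↑ A0≡1 lp))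
                                 (dilSum-leastPositive 0<b β↑ A0≡1 lp))
... | refl = cong (a ∷_) (dilSum-injectiveˡ α β A0≡1 lp 0<α (Linked.tail α↑) 0<β (Linked.tail β↑) tails≗)
  where
  tails≗ : dilSum α A ≗ dilSum β A
  tails≗ = ⊕-cancelˡ (dilate a A) (trans (dilate-zero a A) A0≡1)
             (λ n → trans (sym (dilSum-cons a α A n)) (trans (αA≗βA n) (dilSum-cons a β A n)))

dilSum-injectiveʳ : ∀ {a α A B} → 0 < a → Linked _≤_ (a ∷ α) → A 0 ≡ 1 → B 0 ≡ 1 →
                    dilSum (a ∷ α) A ≗ dilSum (a ∷ α) B → A ≗ B
dilSum-injectiveʳ {a} {α} {A} {B} 0<a sorted A0≡1 B0≡1 αA≗αB = <-rec (λ n → A n ≡ B n) step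
  where
  a≤α : All (a ≤_) α
  a≤α = All.tail (Linked⇒All ≤-trans ≤-refl sorted)

  no-first-increase : ∀ {X Y} n → X 0 ≡ 1 → dilSum (a ∷ α) X ≗ dilSum (a ∷ α) Y →
                      (∀ {m} → m < n → X m ≡ Y m) → X n ≮ Y n
  no-first-increase n X0≡1 αX≗αY below Xn<Yn =
    <-irrefl (αX≗αY (a * n)) (dilSum-mono-< α 0<a a≤α X0≡1 (≤[]-from-prefix below (<⇒≤ Xn<Yn)) Xn<Yn)

  step : ∀ n → (∀ {m} → m < n → A m ≡ B m) → A n ≡ B n
  step n below = ≤-antisym (≮⇒≥ (no-first-increase n B0≡1 (sym ∘ αA≗αB) (sym ∘ below)))
                           (≮⇒≥ (no-first-increase n A0≡1 αA≗αB below))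

corollary1p8 : (A B : Multiset) (α β : List ℕ) →
    InNm A → InNm B → CardGe2 A → CardGe2 B → InZm α → InZm β →
    (∀ n → dilSum α A n ≡ dilSum β B n) →
    ¬ ((∀ n → A n ≡ B n) × α ≡ β) →
    ¬ (∀ n → A n ≡ B n) × α ≢ β
corollary1p8 A B α β A0≡1 B0≡1 |A|≥2 _ (nonEmpty , 0<α , α↑) (_ , 0<β , β↑) αA≗βB distinct = A≢B , α≢β
  where
  A≢B : ¬ A ≗ B
  A≢B A≗B = distinct (A≗B , dilSum-injectiveˡ α β A0≡1 (proj₂ (leastPositive A0≡1 |A|≥2)) 0<α α↑ 0<β β↑
                              (λ n → trans (αA≗βB n) (sym (dilSum-cong β A≗B n))))

  α≢β : α ≢ β
  α≢β refl = distinct (dilSum-injectiveʳ (All.head 0<α) α↑ A0≡1 B0≡1 αA≗βB , refl)
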